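{- Let $G$ be a connected finite $\delta$-hyperbolic graph and let $P(y,x)$ be a shortest path between vertices $y$ and $x$. (i) Any plain $(u,\dots,v)$ of $P(y,x)$ has width $d(u,v)\le 4\delta+1$. Terraces are absent if $\delta=0$ and have width at most $4\delta-1$ otherwise. Plateaus are absent if $\delta\le 1/2$ and have width at most $4\delta-3$ otherwise. (ii) Any plain $(u,\dots,v)$ of $P(y,x)$ with $e(u)>\min\{e(x),e(y)\}+\delta$ has width $d(u,v)\le 2\delta$, and if $(u,\dots,v)$ is a plateau it has width at most $2\delta-2$. In particular, if $\delta=1$, then plateaus on $P(y,x)$ are absent in eccentricity layers $C_k(G)$ for all $k>\min\{e(x),e(y)\}+1-rad(G)$; moreover, plateaus are completely absent if $\delta=1$ and every vertex $c\ne x$ of $P(y,x)$ has $e(c)>e(x)$. (iii) If there are two vertices $u,v\in P(y,x)$ with $e(u)=e(v)\ge\min\{e(x),e(y)\}$, $d(x,\{u,v\})>2\delta$ and $d(y,\{u,v\})>2\delta$, then $d(u,v)\le 2\delta$.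
   Context: $d$ is shortest-path distance; $d(v,S)=\min_{u\in S}d(v,u)$. $G$ is $\delta$-hyperbolic if for any four vertices $u,v,w,x$ the two larger of $d(u,v)+d(w,x)$, $d(u,w)+d(v,x)$, $d(u,x)+d(v,w)$ differ by at most $2\delta$. $e(v)=\max_u d(v,u)$, $rad(G)=\min_v e(v)$, $C_k(G)=\{v: e(v)=rad(G)+k\}$. For a path $P(y,x)=(y=v_0,\dots,v_p=x)$, an edge $(v_j,v_{j+1})$ is horizontal if $e(v_j)=e(v_{j+1})$. A plain is a maximal by inclusion subpath $(v_i,\dots,v_{i+\ell})$ all of whose edges are horizontal; $\ell$ is its width. A plain with $i>0$ and $i+\ell<p$ is a plateau if $e(v_{i-1})<e(v_i)$ and $e(v_{i+\ell+1})<e(v_{i+\ell})$, and a terrace if either $e(v_{i-1})<e(v_i)$ and $e(v_{i+\ell+1})>e(v_{i+\ell})$, or $e(v_{i-1})>e(v_i)$ and $e(v_{i+\ell+1})<e(v_{i+\ell})$. -}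

module Defs where

open import Data.Nat using (ℕ; zero; suc; _+_; _∸_; _≤_; _<_; _⊔_; _⊓_)
open import Data.Bool using (Bool; true; false; _∨_; _∧_; if_then_else_)
open import Data.Fin using (Fin) renaming (_≟_ to _≟ᶠ_)
open import Data.List using (List; foldr; map; allFin)
open import Data.Bool.ListAction using (any)
open import Data.Product using (Σ; ∃; ∃-syntax; _×_; _,_)
open import Data.Sum using (_⊎_)
open import Relation.Nullary using (¬_)
open import Relation.Nullary.Decidable using (⌊_⌋)
open import Relation.Binary.PropositionalEquality using (_≡_; _≢_)

record Graph (n : ℕ) : Set where
  field
    adj    : Fin n → Fin n → Bool
    sym    : ∀ u v → adj u v ≡ adj v u
    irrefl : ∀ u → adj u u ≡ false
open Graph public

reach : ∀ {n} → Graph n → ℕ → Fin n → Fin n → Bool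
reach G zero    u v = ⌊ u ≟ᶠ v ⌋
reach {n} G (suc k) u v =
  reach G k u v ∨ any (λ w → adj G u w ∧ reach G k w v) (allFin n)

Connected : ∀ {n} → Graph n → Set
Connected G = ∀ u v → ∃[ k ] (reach G k u v ≡ true)

-- least k < m with f k ≡ true (returns m if there is none)
first : (ℕ → Bool) → ℕ → ℕ
first f zero    = zero
first f (suc m) = if f zero then zero else suc (first (λ k → f (suc k)) m)

-- shortest-path distance d(u,v) (for a connected graph on n vertices
-- some walk of length < n exists, so the search bound n suffices)
dist : ∀ {n} → Graph n → Fin n → Fin n → ℕ
dist {n} G u v = first (λ k → reach G k u v) n

ecc : ∀ {n} → Graph n → Fin n → ℕ
ecc {n} G v = foldr _⊔_ 0 (map (dist G v) (allFin n))

-- rad(G) = min_v e(v)  (the vertex z only witnesses non-emptiness)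
rad : ∀ {n} → Graph n → Fin n → ℕ
rad {n} G z = foldr _⊓_ (ecc G z) (map (ecc G) (allFin n))

max3 : ℕ → ℕ → ℕ → ℕ
max3 a b c = a ⊔ b ⊔ c

med3 : ℕ → ℕ → ℕ → ℕ
med3 a b c = (a ⊓ b) ⊔ (b ⊓ c) ⊔ (a ⊓ c)

-- G is δ-hyperbolic with h = 2δ: the two larger of the three distance
-- sums differ by at most 2δ = h.
Hyperbolic : ∀ {n} → Graph n → (h : ℕ) → Set
Hyperbolic G h = ∀ u v w x →
  let s₁ = dist G u v + dist G w x
      s₂ = dist G u w + dist G v x
      s₃ = dist G u x + dist G v w
  in max3 s₁ s₂ s₃ ≤ med3 s₁ s₂ s₃ + h

-- A shortest path P(y,x) = (y = v₀, …, v_p = x), given as P : ℕ → vertices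
-- (only the values at indices 0..p matter).
record ShortestPath {n} (G : Graph n) (y x : Fin n) : Set where
  field
    len   : ℕ
    vtx   : ℕ → Fin n
    start : vtx 0 ≡ y
    end   : vtx len ≡ x
    edge  : ∀ j → j < len → adj G (vtx j) (vtx (suc j)) ≡ true
    geod  : len ≡ dist G y x
open ShortestPath public

module _ {n} {G : Graph n} {y x : Fin n} (P : ShortestPath G y x) where
  private
    e : ℕ → ℕ
    e j = ecc G (vtx P j)
    p = len P

  Horizontal : ℕ → Set
  Horizontal j = e j ≡ e (suc j)

  IsPlain : ℕ → ℕ → Set
  IsPlain i ℓ =
    1 ≤ ℓ × i + ℓ ≤ p ×
    (∀ j → i ≤ j → j < i + ℓ → Horizontal j) ×
    (∀ i' → suc i' ≡ i → ¬ Horizontal i') ×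
    (i + ℓ < p → ¬ Horizontal (i + ℓ))

  IsPlateau : ℕ → ℕ → Set
  IsPlateau i ℓ =
    IsPlain i ℓ × 0 < i × i + ℓ < p ×
    e (i ∸ 1) < e i × e (suc (i + ℓ)) < e (i + ℓ)

  IsTerrace : ℕ → ℕ → Set
  IsTerrace i ℓ =
    IsPlain i ℓ × 0 < i × i + ℓ < p ×
    ((e (i ∸ 1) < e i × e (i + ℓ) < e (suc (i + ℓ))) ⊎
     (e i < e (i ∸ 1) × e (suc (i + ℓ)) < e (i + ℓ)))

{-# OPTIONS --safe #-}
module Submission where

-- Write h = 2δ. Everything rests on the bound e(c) ≤ max (e(u) − d(u,c), e(v) − d(c,v)) + h for a
-- vertex c on a geodesic from u to v, which follows from the four-point condition at u, v, c and a
-- vertex farthest from c. On a plain all eccentricities are equal; taking for u and v its ends, or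
-- their outer neighbours where e drops (terraces, plateaus), every vertex c of the plain satisfies
-- d(u,c) ≤ h − (e(c) − e(u)) or the same with v, and a vertex just beyond the range allowed by u
-- violates both. For (ii) and (iii) one of u, v is an end of P: a vertex whose eccentricity exceeds
-- that end's by more than δ is too far from it for its alternative, so the other one holds.

open import Defs
open import Data.Nat using (ℕ; zero; suc; _+_; _≤_; _<_; _⊓_)
open import Data.Fin using (Fin)
open import Data.Product using (_×_)
open import Relation.Nullary using (¬_)
open import Data.Empty using (⊥)
open import Relation.Binary.PropositionalEquality using (_≡_; _≢_)

open import Data.Bool using (true; false; T)
open import Data.Bool.Properties using (T-∨; T-∧; T-≡)
open import Data.List using (List; []; _∷_; map; foldr; allFin)
open import Data.List.Membership.Propositional using (_∈_; lose)
open import Data.List.Membership.Propositional.Properties using (∈-allFin)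
open import Data.List.Relation.Unary.Any using (here; there; satisfied)
open import Data.List.Relation.Unary.Any.Properties using (any⁺; any⁻)
open import Data.Nat using (_⊔_; _∸_; z≤n; s≤s; _≤?_)
open import Data.Nat.Properties
open import Algebra.Properties.CommutativeSemigroup +-commutativeSemigroup
open import Data.Product using (∃-syntax; _,_; proj₂)
open import Data.Sum using (_⊎_; inj₁; inj₂; swap)
open import Function.Base using (_∘_)
open import Function.Bundles using (Equivalence)
open import Relation.Nullary using (yes; no; contradiction)
open import Relation.Nullary.Decidable using (toWitness; fromWitness)
open import Relation.Binary.PropositionalEquality as ≡ using (refl; trans; cong; cong₂; subst; subst₂; module ≡-Reasoning)

open Equivalence using (to; from)

first-≤ : ∀ f m {k} → T (f k) → first f m ≤ k
first-≤ f zero              _  = z≤n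
first-≤ f (suc m) {zero}    fk with f zero
first-≤ f (suc m) {zero}    _  | true  = z≤n
first-≤ f (suc m) {zero}    () | false
first-≤ f (suc m) {suc k}   fk with f zero
... | true  = z≤n
... | false = s≤s (first-≤ (λ j → f (suc j)) m fk)

first-≤-bound : ∀ f m → first f m ≤ m
first-≤-bound f zero = z≤n
first-≤-bound f (suc m) with f zero
... | true  = z≤n
... | false = s≤s (first-≤-bound (λ j → f (suc j)) m)

first-found : ∀ f m → first f m ≡ m ⊎ T (f (first f m))
first-found f zero = inj₁ refl
first-found f (suc m) with f zero in eq
... | true  = inj₂ (from T-≡ eq)
... | false with first-found (λ j → f (suc j)) m
...   | inj₁ none  = inj₁ (cong suc none)
...   | inj₂ found = inj₂ found

foldr-⊔-upper : ∀ {A : Set} (f : A → ℕ) {xs z} → z ∈ xs → f z ≤ foldr _⊔_ 0 (map f xs)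
foldr-⊔-upper f (here refl) = m≤m⊔n _ _
foldr-⊔-upper f (there z∈xs) = ≤-trans (foldr-⊔-upper f z∈xs) (m≤n⊔m _ _)

foldr-⊔-attained : ∀ {A : Set} (f : A → ℕ) (xs : List A) → A → ∃[ w ] (foldr _⊔_ 0 (map f xs) ≤ f w)
foldr-⊔-attained f []       z = z , z≤n
foldr-⊔-attained f (a ∷ xs) z with foldr-⊔-attained f xs z | ≤-total (f a) (foldr _⊔_ 0 (map f xs))
... | w , le | inj₁ fa≤ = w , ⊔-lub (≤-trans fa≤ le) le
... | _      | inj₂ ≥fa = a , ⊔-lub ≤-refl ≥fa

med3≤⊔ : ∀ a b c → med3 a b c ≤ b ⊔ c
med3≤⊔ a b c = ⊔-lub (⊔-lub (≤-trans (m⊓n≤n a b) (m≤m⊔n b c)) (≤-trans (m⊓n≤m b c) (m≤m⊔n b c)))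
                     (≤-trans (m⊓n≤n a c) (m≤n⊔m b c))

≤⊔+⇒ : ∀ {a b c h} → a ≤ b ⊔ c + h → a ≤ b + h ⊎ a ≤ c + h
≤⊔+⇒ {a} {b} {c} {h} le with ⊔-sel b c
... | inj₁ b⊔c≡b = inj₁ (subst (λ t → a ≤ t + h) b⊔c≡b le)
... | inj₂ b⊔c≡c = inj₂ (subst (λ t → a ≤ t + h) b⊔c≡c le)

max3≤med3+h⇒ : ∀ a b c h → max3 a b c ≤ med3 a b c + h → a ≤ b + h ⊎ a ≤ c + h
max3≤med3+h⇒ a b c h le = ≤⊔+⇒ {b = b} {c} {h} (begin
  a                  ≤⟨ ≤-trans (m≤m⊔n a b) (m≤m⊔n (a ⊔ b) c) ⟩
  max3 a b c         ≤⟨ le ⟩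
  med3 a b c + h     ≤⟨ +-monoˡ-≤ h (med3≤⊔ a b c) ⟩
  b ⊔ c + h          ∎)
  where open ≤-Reasoning

gap-cancel : ∀ {a g E X h} → a + E ≤ X + h → g + X ≤ E → a + g ≤ h
gap-cancel {a} {g} {E} {X} {h} a+E≤ g+X≤E = +-cancelʳ-≤ X (a + g) h (begin
  a + g + X    ≡⟨ +-assoc a g X ⟩
  a + (g + X)  ≤⟨ +-monoʳ-≤ a g+X≤E ⟩
  a + E        ≤⟨ a+E≤ ⟩
  X + h        ≡⟨ +-comm X h ⟩
  h + X        ∎)
  where open ≤-Reasoning

gap⇒< : ∀ {q E X h} → h < q → q + E ≤ X + h → E < X
gap⇒< {q} {E} {X} {h} h<q q+E≤ = +-cancelʳ-≤ h (suc E) X (begin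
  suc E + h  ≡⟨ +-suc E h ⟨
  E + suc h  ≤⟨ +-monoʳ-≤ E h<q ⟩
  E + q      ≡⟨ +-comm E q ⟩
  q + E      ≤⟨ q+E≤ ⟩
  X + h      ∎)
  where open ≤-Reasoning

m∸n+[n+o]≡m+o : ∀ {m n} o → n ≤ m → m ∸ n + (n + o) ≡ m + o
m∸n+[n+o]≡m+o {m} {n} o n≤m = trans (≡.sym (+-assoc (m ∸ n) n o)) (cong (_+ o) (m∸n+n≡m n≤m))

+-suc-cancel-≤ : ∀ m k n → m + suc k ≤ n + 1 → m + k ≤ n
+-suc-cancel-≤ m k n le = ≤-pred (subst₂ _≤_ (+-suc m k) (+-comm n 1) le)

EverySplitShort : ℕ → ℕ → ℕ → ℕ → Set
EverySplitShort ℓ A B h = ∀ k j → k + j ≡ ℓ → k + A ≤ h ⊎ j + B ≤ h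

everySplitShort-swap : ∀ {ℓ A B h} → EverySplitShort ℓ A B h → EverySplitShort ℓ B A h
everySplitShort-swap short k j k+j≡ℓ = swap (short j k (trans (+-comm j k) k+j≡ℓ))

-- The split whose left part is k = h + 1 − A is not short on the left, so it is short on the right.
everySplitShort⇒≤ : ∀ {ℓ A B h} → A ≤ suc h → B ≤ suc h → EverySplitShort ℓ A B h →
  ℓ + (A + B) ≤ h + h + 1
everySplitShort⇒≤ {ℓ} {A} {B} {h} A≤ B≤ short with suc h ∸ A ≤? ℓ
... | yes k≤ℓ = short-on-right (short k (ℓ ∸ k) (m+[n∸m]≡n k≤ℓ))
  where
  k = suc h ∸ A
  short-on-right : k + A ≤ h ⊎ ℓ ∸ k + B ≤ h → ℓ + (A + B) ≤ h + h + 1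
  short-on-right (inj₁ k+A≤h) = contradiction (subst (_≤ h) (m∸n+n≡m A≤) k+A≤h) (1+n≰n {h})
  short-on-right (inj₂ j+B≤h) = begin
    ℓ + (A + B)            ≡⟨ cong (_+ (A + B)) (m+[n∸m]≡n k≤ℓ) ⟨
    k + (ℓ ∸ k) + (A + B)  ≡⟨ interchange k (ℓ ∸ k) A B ⟩
    k + A + (ℓ ∸ k + B)    ≤⟨ +-mono-≤ (≤-reflexive (m∸n+n≡m A≤)) j+B≤h ⟩
    suc h + h              ≡⟨ +-comm (suc h) h ⟩
    h + suc h              ≡⟨ +-suc h h ⟩
    suc (h + h)            ≡⟨ +-comm 1 (h + h) ⟩
    h + h + 1              ∎
    where open ≤-Reasoning
... | no ℓ≰k = begin
  ℓ + (A + B)  ≡⟨ +-assoc ℓ A B ⟨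
  ℓ + A + B    ≤⟨ +-mono-≤ ℓ+A≤h B≤ ⟩
  h + suc h    ≡⟨ +-suc h h ⟩
  suc (h + h)  ≡⟨ +-comm 1 (h + h) ⟩
  h + h + 1    ∎
  where open ≤-Reasoning
        ℓ+A≤h : ℓ + A ≤ h
        ℓ+A≤h = ≤-pred (subst (ℓ + A <_) (m∸n+n≡m A≤) (+-monoˡ-< A (≰⇒> ℓ≰k)))

-- Only for h = 0 can A ≤ 2 exceed h + 1; then the split 0 + ℓ forces A = 0.
everySplitShort-slack : ∀ {ℓ A B h} → 1 ≤ ℓ → A ≤ 2 → EverySplitShort ℓ A B h → A ≤ suc h
everySplitShort-slack {h = suc h} _ A≤2 _ = ≤-trans A≤2 (s≤s (s≤s z≤n))
everySplitShort-slack {ℓ} {h = zero} 1≤ℓ _ short with short 0 ℓ refl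
... | inj₁ A≤0 = ≤-trans A≤0 z≤n
... | inj₂ ℓ+B≤0 = contradiction (≤-trans 1≤ℓ (≤-trans (m≤m+n ℓ _) ℓ+B≤0)) λ ()

everySplitShort⇒width : ∀ {ℓ A B h} → 1 ≤ ℓ → A ≤ 2 → B ≤ 2 → EverySplitShort ℓ A B h →
  ℓ + (A + B) ≤ h + h + 1
everySplitShort⇒width 1≤ℓ A≤2 B≤2 short = everySplitShort⇒≤
  (everySplitShort-slack 1≤ℓ A≤2 short)
  (everySplitShort-slack 1≤ℓ B≤2 (everySplitShort-swap short))
  short

module GraphMetric {n} (G : Graph n) where

  Reach : ℕ → Fin n → Fin n → Set
  Reach k u v = T (reach G k u v)

  d : Fin n → Fin n → ℕ
  d = dist G

  reach-refl : ∀ u → Reach 0 u u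
  reach-refl u = fromWitness refl

  reach-suc : ∀ k u v → Reach k u v → Reach (suc k) u v
  reach-suc k u v r = from T-∨ (inj₁ r)

  reach-step : ∀ k u w v → T (adj G u w) → Reach k w v → Reach (suc k) u v
  reach-step k u w v a r = from T-∨ (inj₂ (any⁺ _ (lose {xs = allFin n} (∈-allFin w) (from T-∧ (a , r)))))

  reach-edge : ∀ u v → adj G u v ≡ true → Reach 1 u v
  reach-edge u v a = reach-step 0 u v v (from T-≡ a) (reach-refl v)

  reach-suc⁻ : ∀ k u v → Reach (suc k) u v → Reach k u v ⊎ ∃[ w ] (T (adj G u w) × Reach k w v)
  reach-suc⁻ k u v r with to T-∨ r
  ... | inj₁ r′ = inj₁ r′
  ... | inj₂ a with satisfied (any⁻ _ (allFin n) a)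
  ...   | w , t = inj₂ (w , to T-∧ t)

  reach-trans : ∀ j k u v w → Reach j u v → Reach k v w → Reach (j + k) u w
  reach-trans zero k u v w r₁ r₂ with toWitness r₁
  ... | refl = r₂
  reach-trans (suc j) k u v w r₁ r₂ with reach-suc⁻ j u v r₁
  ... | inj₁ r = reach-suc (j + k) u w (reach-trans j k u v w r r₂)
  ... | inj₂ (z , a , r) = reach-step (j + k) u z w a (reach-trans j k z v w r r₂)

  reach-sym : ∀ k u v → Reach k u v → Reach k v u
  reach-sym zero u v r with toWitness r
  ... | refl = r
  reach-sym (suc k) u v r with reach-suc⁻ k u v r
  ... | inj₁ r′ = reach-suc k v u (reach-sym k u v r′)
  ... | inj₂ (w , a , r′) = subst (λ j → Reach j v u) (+-comm k 1)
          (reach-trans k 1 v w u (reach-sym k w v r′)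
            (reach-step 0 w u u (subst T (Graph.sym G u w) a) (reach-refl u)))

  dist-≤ : ∀ k u v → Reach k u v → d u v ≤ k
  dist-≤ k u v = first-≤ (λ j → reach G j u v) n

  dist-≤-order : ∀ u v → d u v ≤ n
  dist-≤-order u v = first-≤-bound (λ j → reach G j u v) n

  dist-reach : ∀ u v → d u v ≡ n ⊎ Reach (d u v) u v
  dist-reach u v = first-found (λ j → reach G j u v) n

  dist-refl : ∀ u → d u u ≡ 0
  dist-refl u = n≤0⇒n≡0 (dist-≤ 0 u u (reach-refl u))

  -- Connectivity is never needed: an unreachable pair gets the default distance n,
  -- which still dominates every distance.
  dist-triangle : ∀ u v w → d u w ≤ d u v + d v w
  dist-triangle u v w with dist-reach u v | dist-reach v w
  ... | inj₁ duv≡n | _ = ≤-trans (dist-≤-order u w) (subst (_≤ d u v + d v w) duv≡n (m≤m+n _ _))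
  ... | inj₂ _ | inj₁ dvw≡n = ≤-trans (dist-≤-order u w) (subst (_≤ d u v + d v w) dvw≡n (m≤n+m _ _))
  ... | inj₂ r₁ | inj₂ r₂ = dist-≤ _ u w (reach-trans (d u v) (d v w) u v w r₁ r₂)

  dist-sym : ∀ u v → d u v ≡ d v u
  dist-sym u v = ≤-antisym (≤ u v) (≤ v u)
    where
    ≤ : ∀ u v → d u v ≤ d v u
    ≤ u v with dist-reach v u
    ... | inj₁ dvu≡n = subst (d u v ≤_) (≡.sym dvu≡n) (dist-≤-order u v)
    ... | inj₂ r = dist-≤ _ u v (reach-sym (d v u) v u r)

  ecc-≥-dist : ∀ c w → d c w ≤ ecc G c
  ecc-≥-dist c w = foldr-⊔-upper (d c) (∈-allFin w)

  ecc-attained : ∀ c → ∃[ w ] (ecc G c ≤ d c w)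
  ecc-attained c = foldr-⊔-attained (d c) (allFin n) c

  ecc-lipschitz : ∀ u v → ecc G u ≤ d u v + ecc G v
  ecc-lipschitz u v with ecc-attained u
  ... | w , eu≤ = ≤-trans eu≤ (≤-trans (dist-triangle u v w) (+-monoʳ-≤ (d u v) (ecc-≥-dist v w)))

  ecc-gap⇒far : ∀ {k} u w → ecc G w + ecc G w + k < ecc G u + ecc G u → ecc G w + k < d u w + ecc G u
  ecc-gap⇒far {k} u w gap = +-cancelˡ-< (ecc G w) _ _ (begin-strict
    ecc G w + (ecc G w + k)     ≡⟨ +-assoc (ecc G w) (ecc G w) k ⟨
    ecc G w + ecc G w + k       <⟨ gap ⟩
    ecc G u + ecc G u           ≤⟨ +-monoˡ-≤ (ecc G u) (ecc-lipschitz u w) ⟩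
    d u w + ecc G w + ecc G u   ≡⟨ xy∙z≈y∙xz (d u w) (ecc G w) (ecc G u) ⟩
    ecc G w + (d u w + ecc G u) ∎)
    where open ≤-Reasoning

  four-point : ∀ {h} → Hyperbolic G h → ∀ u v w x →
    d u v + d w x ≤ d u w + d v x + h ⊎ d u v + d w x ≤ d u x + d v w + h
  four-point {h} hyp u v w x = max3≤med3+h⇒ _ _ _ h (hyp u v w x)

  -- The bound of the header, written without truncated subtraction.
  ecc-on-geodesic : ∀ {h} → Hyperbolic G h → ∀ {u c v} → d u c + d c v ≡ d u v →
    d c v + ecc G c ≤ ecc G v + h ⊎ d u c + ecc G c ≤ ecc G u + h
  ecc-on-geodesic {h} hyp {u} {c} {v} between with ecc-attained c
  ... | w , ec≤ with four-point hyp u v c w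
  ... | inj₁ le = inj₁ (+-cancelˡ-≤ (d u c) _ _ (begin
    d u c + (d c v + ecc G c)  ≡⟨ +-assoc (d u c) (d c v) (ecc G c) ⟨
    d u c + d c v + ecc G c    ≡⟨ cong (_+ ecc G c) between ⟩
    d u v + ecc G c            ≤⟨ +-monoʳ-≤ (d u v) ec≤ ⟩
    d u v + d c w              ≤⟨ le ⟩
    d u c + d v w + h          ≤⟨ +-monoˡ-≤ h (+-monoʳ-≤ (d u c) (ecc-≥-dist v w)) ⟩
    d u c + ecc G v + h        ≡⟨ +-assoc (d u c) (ecc G v) h ⟩
    d u c + (ecc G v + h)      ∎))
    where open ≤-Reasoning
  ... | inj₂ le = inj₂ (+-cancelʳ-≤ (d c v) _ _ (begin
    d u c + ecc G c + d c v    ≡⟨ xy∙z≈xz∙y (d u c) (ecc G c) (d c v) ⟩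
    d u c + d c v + ecc G c    ≡⟨ cong (_+ ecc G c) between ⟩
    d u v + ecc G c            ≤⟨ +-monoʳ-≤ (d u v) ec≤ ⟩
    d u v + d c w              ≤⟨ le ⟩
    d u w + d v c + h          ≤⟨ +-monoˡ-≤ h (+-monoˡ-≤ (d v c) (ecc-≥-dist u w)) ⟩
    ecc G u + d v c + h        ≡⟨ cong (λ t → ecc G u + t + h) (dist-sym v c) ⟩
    ecc G u + d c v + h        ≡⟨ xy∙z≈xz∙y (ecc G u) (d c v) h ⟩
    ecc G u + h + d c v        ∎))
    where open ≤-Reasoning

module AlongPath {n} {G : Graph n} {y x : Fin n} (P : ShortestPath G y x) where
  open GraphMetric G

  private
    p : ℕ
    p = len P
    v : ℕ → Fin n
    v = vtx P
    e : ℕ → ℕ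
    e j = ecc G (vtx P j)

  m : ℕ
  m = ecc G x ⊓ ecc G y

  path-reach : ∀ s k → s + k ≤ p → Reach k (v s) (v (s + k))
  path-reach s zero _ = subst (λ j → Reach 0 (v s) (v j)) (≡.sym (+-identityʳ s)) (reach-refl (v s))
  path-reach s (suc k) s+1+k≤p = subst₂ (λ j t → Reach j (v s) (v t)) (+-comm k 1) (≡.sym (+-suc s k))
    (reach-trans k 1 _ _ _ (path-reach s k (<⇒≤ s+k<p)) (reach-edge _ _ (edge P (s + k) s+k<p)))
    where
    s+k<p : s + k < p
    s+k<p = subst (_≤ p) (+-suc s k) s+1+k≤p

  subpath-dist : ∀ s k → s + k ≤ p → d (v s) (v (s + k)) ≡ k
  subpath-dist s k s+k≤p = ≤-antisym (dist-≤ k _ _ (path-reach s k s+k≤p))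
    (+-cancelʳ-≤ q k D (+-cancelˡ-≤ s (k + q) (D + q) (begin
      s + (k + q)                    ≡⟨ +-assoc s k q ⟨
      s + k + q                      ≡⟨ m+[n∸m]≡n s+k≤p ⟩
      p                              ≡⟨ geod P ⟩
      d y x                          ≡⟨ endpoints ⟨
      d (v 0) (v p)                  ≤⟨ dist-triangle _ (v s) _ ⟩
      d (v 0) (v s) + d (v s) (v p)  ≤⟨ +-mono-≤ (dist-≤ s _ _ (path-reach 0 s s≤p))
                                                 (dist-triangle _ (v (s + k)) _) ⟩
      s + (D + d (v (s + k)) (v p))  ≤⟨ +-monoʳ-≤ s (+-monoʳ-≤ D tail≤q) ⟩
      s + (D + q)                    ∎)))
    where
    open ≤-Reasoning hiding (start)
    endpoints : d (v 0) (v p) ≡ d y x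
    endpoints = cong₂ d (ShortestPath.start P) (end P)
    q = p ∸ (s + k)
    D = d (v s) (v (s + k))
    s≤p : s ≤ p
    s≤p = ≤-trans (m≤m+n s k) s+k≤p
    tail≤q : d (v (s + k)) (v p) ≤ q
    tail≤q = subst (λ t → d (v (s + k)) (v t) ≤ q) (m+[n∸m]≡n s+k≤p)
      (dist-≤ q _ _ (path-reach (s + k) q (≤-reflexive (m+[n∸m]≡n s+k≤p))))

  dist-from-start : ∀ {i} → i ≤ p → d y (v i) ≡ i
  dist-from-start {i} i≤p = subst (λ t → d t (v i) ≡ i) (start P) (subpath-dist 0 i i≤p)

  dist-to-end : ∀ {i q} → i + q ≡ p → d (v i) x ≡ q
  dist-to-end {i} {q} i+q≡p = subst (λ t → d (v i) t ≡ q) (trans (cong v i+q≡p) (end P))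
    (subpath-dist i q (≤-reflexive i+q≡p))

  vtx≢end : ∀ {i} → i < p → v i ≢ x
  vtx≢end {i} i<p v≡x = contradiction (trans (≡.sym dist≡) (trans (cong (λ t → d t x) v≡x) (dist-refl x))) λ ()
    where
    dist≡ : d (v i) x ≡ suc (p ∸ suc i)
    dist≡ = dist-to-end (trans (+-suc i (p ∸ suc i)) (m+[n∸m]≡n i<p))

  plain-level : ∀ {i ℓ k} → IsPlain P i ℓ → k ≤ ℓ → e (i + k) ≡ e i
  plain-level {i} {k = zero} _ _ = cong e (+-identityʳ i)
  plain-level {i} {k = suc k} pl@(_ , _ , horizontal , _) k<ℓ = begin
    e (i + suc k)    ≡⟨ cong e (+-suc i k) ⟩
    e (suc (i + k))  ≡⟨ horizontal (i + k) (m≤m+n i k) (+-monoʳ-< i k<ℓ) ⟨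
    e (i + k)        ≡⟨ plain-level pl (<⇒≤ k<ℓ) ⟩
    e i              ∎
    where open ≡-Reasoning

  plain-level-end : ∀ {i ℓ} → IsPlain P i ℓ → e (i + ℓ) ≡ e i
  plain-level-end pl = plain-level pl ≤-refl

  ecc-end : e p ≡ ecc G x
  ecc-end = cong (ecc G) (end P)

  ecc-start : e 0 ≡ ecc G y
  ecc-start = cong (ecc G) (start P)

  high⇒far-from-end : ∀ {c q k} → c + q ≡ p → ecc G x + ecc G x + k < e c + e c → ¬ (q + e c ≤ e p + k)
  high⇒far-from-end {c} {q} {k} c+q≡p high close = <⇒≱ (ecc-gap⇒far (v c) x high)
    (subst₂ (λ t u → t + e c ≤ u + k) (≡.sym (dist-to-end c+q≡p)) ecc-end close)

  high⇒far-from-start : ∀ {c k} → c ≤ p → ecc G y + ecc G y + k < e c + e c → ¬ (c + e c ≤ e 0 + k)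
  high⇒far-from-start {c} {k} c≤p high close = <⇒≱ (ecc-gap⇒far (v c) y high)
    (subst₂ (λ t u → t + e c ≤ u + k) (trans (≡.sym (dist-from-start c≤p)) (dist-sym y (v c))) ecc-start close)

  module WithHyperbolicity {h} (hyp : Hyperbolic G h) where

    path-ecc-split : ∀ {s a c b r} → s + a ≡ c → c + b ≡ r → r ≤ p →
      b + e c ≤ e r + h ⊎ a + e c ≤ e s + h
    path-ecc-split {s} {a} {_} {b} refl refl r≤p =
      subst₂ (λ dcr dsc → dcr + e (s + a) ≤ e (s + a + b) + h ⊎ dsc + e (s + a) ≤ e s + h)
        dcr≡b dsc≡a (ecc-on-geodesic hyp (trans (cong₂ _+_ dsc≡a dcr≡b) (≡.sym dsr≡a+b)))
      where
      dsc≡a : d (v s) (v (s + a)) ≡ a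
      dsc≡a = subpath-dist s a (≤-trans (m≤m+n (s + a) b) r≤p)
      dcr≡b : d (v (s + a)) (v (s + a + b)) ≡ b
      dcr≡b = subpath-dist (s + a) b r≤p
      dsr≡a+b : d (v s) (v (s + a + b)) ≡ a + b
      dsr≡a+b = trans (cong (λ t → d (v s) (v t)) (+-assoc s a b))
        (subpath-dist s (a + b) (subst (_≤ p) (+-assoc s a b) r≤p))

    -- The plain is extended by α vertices to the left and β to the right, along which
    -- e drops by at least α resp. β; a vertex of the plain splits it into k + j.
    plain-everySplitShort : ∀ {i ℓ α β} → IsPlain P i ℓ → α ≤ i → β + (i + ℓ) ≤ p →
      α + e (i ∸ α) ≤ e i → β + e (β + (i + ℓ)) ≤ e (i + ℓ) →
      EverySplitShort ℓ (α + α) (β + β) h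
    plain-everySplitShort {i} {ℓ} {α} {β} pl α≤i r≤p left-drop right-drop k j k+j≡ℓ =
      short-side (path-ecc-split (m∸n+[n+o]≡m+o k α≤i) c+b≡r r≤p)
      where
      c+b≡r : i + k + (j + β) ≡ β + (i + ℓ)
      c+b≡r = begin
        i + k + (j + β)  ≡⟨ +-assoc (i + k) j β ⟨
        i + k + j + β    ≡⟨ cong (_+ β) (+-assoc i k j) ⟩
        i + (k + j) + β  ≡⟨ cong (λ t → i + t + β) k+j≡ℓ ⟩
        i + ℓ + β        ≡⟨ +-comm (i + ℓ) β ⟩
        β + (i + ℓ)      ∎
        where open ≡-Reasoning
      level : e (i + k) ≡ e i
      level = plain-level pl (m+n≤o⇒m≤o k (≤-reflexive k+j≡ℓ))
      short-side : j + β + e (i + k) ≤ e (β + (i + ℓ)) + h ⊎ α + k + e (i + k) ≤ e (i ∸ α) + h →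
        k + (α + α) ≤ h ⊎ j + (β + β) ≤ h
      short-side (inj₁ right-short) = inj₂ (subst (_≤ h) (+-assoc j β β) (gap-cancel right-short
        (subst (β + e (β + (i + ℓ)) ≤_) (trans (plain-level-end pl) (≡.sym level)) right-drop)))
      short-side (inj₂ left-short) = inj₁ (subst (_≤ h) (xy∙z≈y∙xz α k α) (gap-cancel left-short
        (subst (α + e (i ∸ α) ≤_) (≡.sym level) left-drop)))

    plain-width : ∀ {i ℓ} → IsPlain P i ℓ → ℓ ≤ h + h + 1
    plain-width {ℓ = ℓ} pl@(1≤ℓ , i+ℓ≤p , _) = subst (_≤ h + h + 1) (+-identityʳ ℓ)
      (everySplitShort⇒width 1≤ℓ z≤n z≤n (plain-everySplitShort {α = 0} {β = 0} pl z≤n i+ℓ≤p ≤-refl ≤-refl))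

    terrace-width : ∀ {i ℓ} → IsTerrace P i ℓ → ℓ + 1 ≤ h + h
    terrace-width {ℓ = ℓ} (pl@(1≤ℓ , i+ℓ≤p , _) , 0<i , _ , inj₁ (ascent , _)) =
      +-suc-cancel-≤ ℓ 1 (h + h) (everySplitShort⇒width 1≤ℓ ≤-refl z≤n
        (plain-everySplitShort {α = 1} {β = 0} pl 0<i i+ℓ≤p ascent ≤-refl))
    terrace-width {ℓ = ℓ} (pl@(1≤ℓ , _) , _ , i+ℓ<p , inj₂ (_ , descent)) =
      +-suc-cancel-≤ ℓ 1 (h + h) (everySplitShort⇒width 1≤ℓ z≤n ≤-refl
        (plain-everySplitShort {α = 0} {β = 1} pl z≤n i+ℓ<p ≤-refl descent))

    plateau-width : ∀ {i ℓ} → IsPlateau P i ℓ → ℓ + 3 ≤ h + h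
    plateau-width {ℓ = ℓ} (pl@(1≤ℓ , _) , 0<i , i+ℓ<p , ascent , descent) =
      +-suc-cancel-≤ ℓ 3 (h + h) (everySplitShort⇒width 1≤ℓ ≤-refl ≤-refl
        (plain-everySplitShort {α = 1} {β = 1} pl 0<i i+ℓ<p ascent descent))

    terrace-absent : h ≡ 0 → ∀ {i ℓ} → ¬ IsTerrace P i ℓ
    terrace-absent h≡0 {ℓ = ℓ} terrace = contradiction
      (≤-trans (m≤n+m 1 ℓ) (subst (λ t → ℓ + 1 ≤ t + t) h≡0 (terrace-width terrace))) λ ()

    plateau-absent : h ≤ 1 → ∀ {i ℓ} → ¬ IsPlateau P i ℓ
    plateau-absent h≤1 {ℓ = ℓ} plateau =
      n≮n 2 (≤-trans (m≤n+m 3 ℓ) (≤-trans (plateau-width plateau) (+-mono-≤ h≤1 h≤1)))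

    high-plain-width-x : ∀ {i ℓ α} → IsPlain P i ℓ → α ≤ i → α + e (i ∸ α) ≤ e i →
      ecc G x + ecc G x + h < e i + e i → ℓ + (α + α) ≤ h
    high-plain-width-x {i} {ℓ} {α} pl@(_ , i+ℓ≤p , _) α≤i left-drop high
      with path-ecc-split (m∸n+[n+o]≡m+o ℓ α≤i) (m+[n∸m]≡n i+ℓ≤p) ≤-refl
    ... | inj₁ towards-x = contradiction towards-x
            (high⇒far-from-end (m+[n∸m]≡n i+ℓ≤p) (subst (λ t → _ < t + t) (≡.sym (plain-level-end pl)) high))
    ... | inj₂ left-short = subst (_≤ h) (xy∙z≈y∙xz α ℓ α)
            (gap-cancel left-short (subst (α + e (i ∸ α) ≤_) (≡.sym (plain-level-end pl)) left-drop))

    high-plain-width-y : ∀ {i ℓ β} → IsPlain P i ℓ → β + (i + ℓ) ≤ p → β + e (β + (i + ℓ)) ≤ e (i + ℓ) →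
      ecc G y + ecc G y + h < e i + e i → ℓ + (β + β) ≤ h
    high-plain-width-y {i} {ℓ} {β} pl@(_ , i+ℓ≤p , _) r≤p right-drop high
      with path-ecc-split {0} refl (trans (≡.sym (+-assoc i ℓ β)) (+-comm (i + ℓ) β)) r≤p
    ... | inj₁ right-short = subst (_≤ h) (+-assoc ℓ β β)
            (gap-cancel right-short (subst (β + e (β + (i + ℓ)) ≤_) (plain-level-end pl) right-drop))
    ... | inj₂ towards-y = contradiction towards-y (high⇒far-from-start (≤-trans (m≤m+n i ℓ) i+ℓ≤p) high)

    high-plain-width : ∀ {i ℓ} → IsPlain P i ℓ → m + m + h < e i + e i →
      ℓ ≤ h × (IsPlateau P i ℓ → ℓ + 2 ≤ h)
    high-plain-width {i} {ℓ} pl@(_ , i+ℓ≤p , _) high with ≤-total (ecc G x) (ecc G y)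
    ... | inj₁ x≤y =
      subst (_≤ h) (+-identityʳ ℓ) (high-plain-width-x {α = 0} pl z≤n ≤-refl high-x) ,
      λ (_ , 0<i , _ , ascent , _) → high-plain-width-x {α = 1} pl 0<i ascent high-x
      where high-x = subst (λ t → t + t + h < e i + e i) (m≤n⇒m⊓n≡m x≤y) high
    ... | inj₂ y≤x =
      subst (_≤ h) (+-identityʳ ℓ) (high-plain-width-y {β = 0} pl i+ℓ≤p ≤-refl high-y) ,
      λ (_ , _ , i+ℓ<p , _ , descent) → high-plain-width-y {β = 1} pl i+ℓ<p descent high-y
      where high-y = subst (λ t → t + t + h < e i + e i) (m≥n⇒m⊓n≡n y≤x) high

    plateau-low : h ≤ 2 → ∀ {i ℓ} → IsPlateau P i ℓ → ¬ (m + 1 < e i)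
    plateau-low h≤2 {i} {ℓ} plateau@(pl@(1≤ℓ , _) , _) m+1<ei =
      contradiction (+-cancelʳ-≤ 2 ℓ 0 (≤-trans (proj₂ (high-plain-width pl high) plateau) h≤2))
        (λ ℓ≤0 → contradiction (≤-trans 1≤ℓ ℓ≤0) λ ())
      where
      high : m + m + h < e i + e i
      high = begin-strict
        m + m + h        ≤⟨ +-monoʳ-≤ (m + m) h≤2 ⟩
        m + m + 2        ≡⟨ interchange m 1 m 1 ⟨
        m + 1 + (m + 1)  <⟨ +-mono-< m+1<ei m+1<ei ⟩
        e i + e i        ∎
        where open ≤-Reasoning

    plateau-low-above-x : h ≤ 2 → (∀ j → j ≤ p → v j ≢ x → ecc G x < e j) →
      ∀ {i ℓ} → ¬ IsPlateau P i ℓ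
    plateau-low-above-x h≤2 above {suc i} plateau@((_ , i+ℓ≤p , _) , _ , _ , ascent , _) =
      plateau-low h≤2 plateau (begin-strict
        m + 1          ≤⟨ +-monoˡ-≤ 1 (m⊓n≤m (ecc G x) (ecc G y)) ⟩
        ecc G x + 1    ≡⟨ +-comm (ecc G x) 1 ⟩
        suc (ecc G x)  ≤⟨ above i (<⇒≤ i<p) (vtx≢end i<p) ⟩
        e i            <⟨ ascent ⟩
        e (suc i)      ∎)
      where
      open ≤-Reasoning
      i<p : i < p
      i<p = ≤-trans (m≤m+n (suc i) _) i+ℓ≤p

    level-pair-close-ordered : ∀ {a b} → a ≤ b → b ≤ p → e a ≡ e b → m ≤ e a →
      h < d x (v b) → h < d y (v a) → d (v a) (v b) ≤ h
    -- Were a and b more than h apart, the bound at b towards x and at a towards y would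
    -- put their common eccentricity below both e(x) and e(y).
    level-pair-close-ordered {a} {b} a≤b b≤p level m≤ea far-x far-y with b ∸ a ≤? h
    ... | yes ℓ≤h = subst (λ t → d (v a) (v t) ≤ h) (m+[n∸m]≡n a≤b)
            (subst (_≤ h) (≡.sym (subpath-dist a (b ∸ a) (subst (_≤ p) (≡.sym (m+[n∸m]≡n a≤b)) b≤p))) ℓ≤h)
    ... | no ℓ≰h = contradiction m≤ea (<⇒≱ (⊓-glb below-x below-y))
      where
      ℓ = b ∸ a
      a+ℓ≡b : a + ℓ ≡ b
      a+ℓ≡b = m+[n∸m]≡n a≤b
      not-short : ∀ {E E′} → E ≡ E′ → ¬ (ℓ + E ≤ E′ + h)
      not-short {E} E≡E′ short = ℓ≰h (subst (_≤ h) (+-identityʳ ℓ) (gap-cancel short (≤-reflexive (≡.sym E≡E′))))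
      below-x : e a < ecc G x
      below-x with path-ecc-split {a} a+ℓ≡b (m+[n∸m]≡n b≤p) ≤-refl
      ... | inj₁ towards-x = subst (_< ecc G x) (≡.sym level) (gap⇒< far-x
              (subst₂ (λ t u → t + e b ≤ u + h)
                (trans (≡.sym (dist-to-end (m+[n∸m]≡n b≤p))) (dist-sym (v b) x)) ecc-end towards-x))
      ... | inj₂ short = contradiction short (not-short (≡.sym level))
      below-y : e a < ecc G y
      below-y with path-ecc-split {0} refl a+ℓ≡b b≤p
      ... | inj₁ short = contradiction short (not-short level)
      ... | inj₂ towards-y = gap⇒< far-y
              (subst₂ (λ t u → t + e a ≤ u + h) (≡.sym (dist-from-start (≤-trans a≤b b≤p))) ecc-start towards-y)

    level-pair-close : ∀ a b → a ≤ p → b ≤ p → e a ≡ e b → m ≤ e a →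
      h < d x (v a) ⊓ d x (v b) → h < d y (v a) ⊓ d y (v b) → d (v a) (v b) ≤ h
    level-pair-close a b a≤p b≤p level m≤ea far-x far-y with ≤-total a b
    ... | inj₁ a≤b = level-pair-close-ordered a≤b b≤p level m≤ea
            (<-≤-trans far-x (m⊓n≤n _ _)) (<-≤-trans far-y (m⊓n≤m _ _))
    ... | inj₂ b≤a = subst (_≤ h) (dist-sym (v b) (v a))
            (level-pair-close-ordered b≤a a≤p (≡.sym level) (subst (m ≤_) level m≤ea)
              (<-≤-trans far-x (m⊓n≤m _ _)) (<-≤-trans far-y (m⊓n≤n _ _)))

theorem16 : ∀ {n} (G : Graph n) (h : ℕ) → Connected G → Hyperbolic G h →
  ∀ (y x : Fin n) (P : ShortestPath G y x) →
  let e = λ j → ecc G (vtx P j)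
      m = ecc G x ⊓ ecc G y
  in
  -- (i)
  (∀ i ℓ → IsPlain P i ℓ → ℓ ≤ h + h + 1) ×
  (h ≡ 0 → ∀ i ℓ → ¬ IsTerrace P i ℓ) ×
  (1 ≤ h → ∀ i ℓ → IsTerrace P i ℓ → ℓ + 1 ≤ h + h) ×
  (h ≤ 1 → ∀ i ℓ → ¬ IsPlateau P i ℓ) ×
  (2 ≤ h → ∀ i ℓ → IsPlateau P i ℓ → ℓ + 3 ≤ h + h) ×
  -- (ii)
  (∀ i ℓ → IsPlain P i ℓ → m + m + h < e i + e i →
    ℓ ≤ h × (IsPlateau P i ℓ → ℓ + 2 ≤ h)) ×
  (h ≡ 2 → ∀ k i ℓ → IsPlateau P i ℓ → e i ≡ rad G x + k →
    m + 1 < rad G x + k → ⊥) ×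
  (h ≡ 2 → (∀ j → j ≤ len P → vtx P j ≢ x → ecc G x < e j) →
    ∀ i ℓ → ¬ IsPlateau P i ℓ) ×
  -- (iii)
  (∀ a b → a ≤ len P → b ≤ len P → e a ≡ e b → m ≤ e a →
    h < dist G x (vtx P a) ⊓ dist G x (vtx P b) →
    h < dist G y (vtx P a) ⊓ dist G y (vtx P b) →
    dist G (vtx P a) (vtx P b) ≤ h)
theorem16 G h _ hyp y x P =
  (λ _ _ → plain-width) ,
  (λ h≡0 _ _ → terrace-absent h≡0) ,
  (λ _ _ _ → terrace-width) ,
  (λ h≤1 _ _ → plateau-absent h≤1) ,
  (λ _ _ _ → plateau-width) ,
  (λ _ _ → high-plain-width) ,
  (λ h≡2 _ _ _ plateau ei≡ → plateau-low (≤-reflexive h≡2) plateau ∘ subst (m + 1 <_) (≡.sym ei≡)) ,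
  (λ h≡2 above _ _ → plateau-low-above-x (≤-reflexive h≡2) above) ,
  level-pair-close
  where
  open AlongPath P
  open WithHyperbolicity hyp
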